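{- Let $P,Q$ be processes and $\mathsf{h}\notin\mathrm{pt}(P)\cup\mathrm{pt}(Q)$. If $P\leqslant Q$, then $\mathrm{gw}(P,\mathsf{h})\leqslant\mathrm{gw}(Q,\mathsf{h})$.
   Context: Processes are possibly infinite regular trees generated coinductively by $P ::= \mathbf{0}\mid \mathsf{p}?\Lambda\mid \mathsf{p}!\Lambda$ with $\Lambda=\{\ell_1.P_1,\dots,\ell_n.P_n\}$ ($n\ge1$, distinct messages); $\mathsf{p}!\ell.P$ denotes a one-branch output. $\Lambda_1\oplus\Lambda_2$ denotes a union with disjoint message sets. $\mathrm{pt}(P)$: participants occurring in $P$. Structural preorder $\leqslant$: largest relation with $P\leqslant Q$ implying $P=Q=\mathbf{0}$, or $P=\mathsf{p}?(\{\ell_i.P_i\}_{i\le n}\oplus\Lambda)$, $Q=\mathsf{p}?\{\ell_i.Q_i\}_{i\le n}$ with $P_i\leqslant Q_i$, or $P=\mathsf{p}!\{\ell_i.P_i\}_{i\le n}$, $Q=\mathsf{p}!\{\ell_i.Q_i\}_{i\le n}$ with $P_i\leqslant Q_i$. Gateway (coinductive, for $\mathsf{h}\notin\mathrm{pt}(P)$): $\mathrm{gw}(\mathbf{0},\mathsf{h})=\mathbf{0}$; $\mathrm{gw}(\mathsf{p}?\{\ell_i.P_i\},\mathsf{h})=\mathsf{p}?\{\ell_i.\mathsf{h}!\ell_i.\mathrm{gw}(P_i,\mathsf{h})\}$; $\mathrm{gw}(\mathsf{p}!\{\ell_i.P_i\},\mathsf{h})=\mathsf{h}?\{\ell_i.\mathsf{p}!\ell_i.\mathrm{gw}(P_i,\mathsf{h})\}$.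 -}

module Defs where

open import Data.Nat using (ℕ)
open import Data.Fin using (Fin; zero)
open import Data.Product using (Σ; ∃; ∃-syntax; _×_; _,_)
open import Data.List using (List)
open import Data.List.Membership.Propositional using (_∈_)
open import Function.Definitions using (Injective)
open import Relation.Binary.PropositionalEquality using (_≡_; refl)

Participant : Set
Participant = ℕ

Label : Set
Label = ℕ

-- Processes as (possibly infinite) trees, presented as the unfolding of a
-- graph: a set of states, each carrying one node of the tree, and a root.

record Branches (S : Set) : Set where
  constructor branches
  field
    arity    : ℕ                       -- n = suc arity ≥ 1
    lab      : Fin (ℕ.suc arity) → Label
    cont     : Fin (ℕ.suc arity) → S
    distinct : Injective _≡_ _≡_ lab
open Branches public

data Node (S : Set) : Set where
  end : Node S
  inp : Participant → Branches S → Node S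
  out : Participant → Branches S → Node S

record Proc : Set₁ where
  field
    State : Set
    node  : State → Node State
    root  : State
open Proc public

-- Regular: the process is presented by a finite graph
-- (finitely many states), i.e. a regular tree.
Finite : Set → Set
Finite S = Σ (List S) λ xs → ∀ s → s ∈ xs

Regular : Proc → Set
Regular P = Finite (State P)

data Succ {S : Set} : Node S → S → Set where
  inp-succ : ∀ p Λ i → Succ (inp p Λ) (cont Λ i)
  out-succ : ∀ p Λ i → Succ (out p Λ) (cont Λ i)

data Reach (P : Proc) : State P → Set where
  here : Reach P (root P)
  step : ∀ {s t} → Reach P s → Succ (node P s) t → Reach P t

data Mentions {S : Set} : Participant → Node S → Set where
  inp-m : ∀ p Λ → Mentions p (inp p Λ)
  out-m : ∀ p Λ → Mentions p (out p Λ)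

_∈pt_ : Participant → Proc → Set
p ∈pt P = ∃[ s ] (Reach P s × Mentions p (node P s))

-- Structural preorder ⩽ (the largest relation closed under the clauses),
-- given as: P ⩽ Q iff some relation R satisfying the clauses relates
-- the roots of P and Q.

data NodeLe {S T : Set} (R : S → T → Set) : Node S → Node T → Set where
  end-le : NodeLe R end end
  -- P = p?({ℓᵢ.Pᵢ}ᵢ ⊕ Λ), Q = p?{ℓᵢ.Qᵢ}ᵢ, Pᵢ R Qᵢ
  inp-le : ∀ p (Λ : Branches S) (Λ′ : Branches T) →
           (∀ j → ∃[ i ] (lab Λ i ≡ lab Λ′ j × R (cont Λ i) (cont Λ′ j))) →
           NodeLe R (inp p Λ) (inp p Λ′)
  -- P = p!{ℓᵢ.Pᵢ}ᵢ, Q = p!{ℓᵢ.Qᵢ}ᵢ (same message set), Pᵢ R Qᵢ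
  out-le : ∀ p (Λ : Branches S) (Λ′ : Branches T) →
           (∀ j → ∃[ i ] (lab Λ i ≡ lab Λ′ j × R (cont Λ i) (cont Λ′ j))) →
           (∀ i → ∃[ j ] (lab Λ i ≡ lab Λ′ j)) →
           NodeLe R (out p Λ) (out p Λ′)

IsStructSim : (P Q : Proc) → (State P → State Q → Set) → Set
IsStructSim P Q R = ∀ s t → R s t → NodeLe R (node P s) (node Q t)

_⩽_ : Proc → Proc → Set₁
P ⩽ Q = Σ (State P → State Q → Set) λ R → IsStructSim P Q R × R (root P) (root Q)

single : {S : Set} → Label → S → Branches S
single ℓ s = branches 0 (λ _ → ℓ) (λ _ → s) inj
  where
  inj : Injective _≡_ _≡_ (λ (_ : Fin 1) → ℓ)
  inj {zero} {zero} _ = refl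

-- states of gw(P,h): gw(s) for each state s of P, and intermediate
-- one-branch outputs  q!ℓ.gw(s).
data GwState (S : Set) : Set where
  main : S → GwState S
  mid  : Participant → Label → S → GwState S

gwBranches : {S : Set} → Participant → Branches S → Branches (GwState S)
gwBranches q Λ = branches (arity Λ) (lab Λ) (λ i → mid q (lab Λ i) (cont Λ i)) (distinct Λ)

gwNode : {S : Set} → Participant → (S → Node S) → GwState S → Node (GwState S)
gwNode h nd (main s) with nd s
... | end     = end
... | inp p Λ = inp p (gwBranches h Λ)   -- p?{ℓᵢ. h!ℓᵢ.gw(Pᵢ,h)}
... | out p Λ = inp h (gwBranches p Λ)   -- h?{ℓᵢ. p!ℓᵢ.gw(Pᵢ,h)}
gwNode h nd (mid q ℓ s) = out q (single ℓ (main s))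

gw : Proc → Participant → Proc
gw P h = record
  { State = GwState (State P)
  ; node  = gwNode h (node P)
  ; root  = main (root P)
  }

-- A structural simulation R between P and Q lifts to gw(P,h) and gw(Q,h):
-- relate gw(s) to gw(t) when s R t, and q!ℓ.gw(s) to q!ℓ.gw(t) likewise.
-- Each node of gw only relabels branches and inserts one-branch outputs,
-- so every clause of ⩽ for R yields the corresponding clause for the lift.
-- An output p!Λ becomes an input h?Λ, where only the forward
-- branch-matching condition is required.
module Submission where

open import Defs
open import Relation.Nullary using (¬_)
open import Data.Product using (∃-syntax; _×_; _,_)
open import Data.Fin using (zero)
open import Relation.Binary.PropositionalEquality using (_≡_; refl)

data GwRel {S T : Set} (R : S → T → Set) : GwState S → GwState T → Set where
  main : ∀ {s t} → R s t → GwRel R (main s) (main t)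
  mid  : ∀ {s t} q ℓ → R s t → GwRel R (mid q ℓ s) (mid q ℓ t)

BranchesLe : {S T : Set} → (S → T → Set) → Branches S → Branches T → Set
BranchesLe R Λ Λ′ = ∀ j → ∃[ i ] (lab Λ i ≡ lab Λ′ j × R (cont Λ i) (cont Λ′ j))

gwBranches-mono : ∀ {S T} {R : S → T → Set} q {Λ : Branches S} {Λ′ : Branches T} →
                  BranchesLe R Λ Λ′ →
                  BranchesLe (GwRel R) (gwBranches q Λ) (gwBranches q Λ′)
gwBranches-mono {R = R} q match j with match j
... | i , ℓᵢ≡ℓⱼ , r = i , ℓᵢ≡ℓⱼ , mid-cong ℓᵢ≡ℓⱼ r
  where
  mid-cong : ∀ {ℓ ℓ′ s t} → ℓ ≡ ℓ′ → R s t → GwRel R (mid q ℓ s) (mid q ℓ′ t)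
  mid-cong refl r = mid q _ r

gw-sim : ∀ {P Q R} h → IsStructSim P Q R → IsStructSim (gw P h) (gw Q h) (GwRel R)
gw-sim {P} {Q} h sim _ _ (main {s} {t} r) with node P s | node Q t | sim s t r
... | .end       | .end        | end-le =
  end-le
... | .(inp p Λ) | .(inp p Λ′) | inp-le p Λ Λ′ match =
  inp-le p _ _ (gwBranches-mono h {Λ} {Λ′} match)
... | .(out p Λ) | .(out p Λ′) | out-le p Λ Λ′ match _ =
  inp-le h _ _ (gwBranches-mono p {Λ} {Λ′} match)
gw-sim h sim _ _ (mid q ℓ r) =
  out-le q _ _ (λ { zero → zero , refl , main r }) (λ { zero → zero , refl })

gw-mono : ∀ {P Q} h → P ⩽ Q → gw P h ⩽ gw Q h
gw-mono {P} {Q} h (R , sim , r) = GwRel R , gw-sim {P} {Q} h sim , main r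

mainTheorem11 : (P Q : Proc) (h : Participant) →
                Regular P → Regular Q →
                ¬ (h ∈pt P) → ¬ (h ∈pt Q) →
                P ⩽ Q → gw P h ⩽ gw Q h
mainTheorem11 P Q h _ _ _ _ = gw-mono h
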